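{- For integers $k \ge r \ge 3$ and $1 \le i \le k-r+1$, $\beta_i(k,r) \le \beta_i(k-1,r-1) + i + 1$.
   Context: A $k$-partite graph comes with a fixed partition of its vertex set into $k$ parts (parts may be empty). For $k \ge r \ge 2$ and $1 \le i \le k-r+1$, $\beta_i(k,r)$ is the minimum number of vertices of a $K_r$-free $k$-partite graph such that, for every choice of $k-i$ of its parts, the subgraph induced by those parts contains a $K_{r-1}$. -}

module Defs where

open import Data.Nat using (ℕ; _≤_; _∸_)
open import Data.Fin using (Fin)
open import Data.Fin.Subset using (Subset; _∈_; ∣_∣)
open import Data.Product using (Σ; ∃; _×_)
open import Relation.Binary.PropositionalEquality using (_≡_; _≢_)
open import Relation.Nullary using (¬_)
open import Level using (0ℓ)

-- A k-partite graph on the vertex set Fin n: a (simple, undirected) graph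
-- together with a fixed assignment of each vertex to one of k parts
-- (parts may be empty); edges only join vertices in different parts.
record PartiteGraph (k n : ℕ) : Set₁ where
  field
    part  : Fin n → Fin k
    Adj   : Fin n → Fin n → Set
    sym   : ∀ {u v} → Adj u v → Adj v u
    irrefl : ∀ {u} → ¬ Adj u u
    cross : ∀ {u v} → Adj u v → part u ≢ part v

open PartiteGraph public

IsClique : ∀ {k n s} → PartiteGraph k n → (Fin s → Fin n) → Set
IsClique {s = s} G f = ∀ (a b : Fin s) → a ≢ b → Adj G (f a) (f b)

HasClique : ∀ {k n} → PartiteGraph k n → ℕ → Set
HasClique {n = n} G s = Σ (Fin s → Fin n) λ f → IsClique G f

HasCliqueIn : ∀ {k n} → PartiteGraph k n → Subset k → ℕ → Set
HasCliqueIn {n = n} G S s =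
  Σ (Fin s → Fin n) λ f → IsClique G f × (∀ a → part G (f a) ∈ S)

Good : (i k r n : ℕ) → PartiteGraph k n → Set
Good i k r n G =
  ¬ HasClique G r ×
  (∀ (S : Subset k) → ∣ S ∣ ≡ k ∸ i → HasCliqueIn G S (r ∸ 1))

Achievable : (i k r n : ℕ) → Set₁
Achievable i k r n = Σ (PartiteGraph k n) (Good i k r n)

IsBeta : (i k r b : ℕ) → Set₁
IsBeta i k r b = Achievable i k r b × (∀ n → Achievable i k r n → b ≤ n)

module Submission where

-- Let H be a (k-1)-partite graph on m vertices witnessing
-- β_i(k-1,r-1).  Shift its parts to 1,…,k-1 and add an independent set of
-- new vertices w_0,…,w_i, where w_j lies in part j and is joined to every old
-- vertex outside part j.  A clique of the new graph G contains at most one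
-- new vertex, so a K_r in G would leave a K_{r-1} in H; hence G is K_r-free.
-- If a set S of k-i parts contains part 0, the other parts of S carry a
-- K_{r-2} of H, which w_0 extends; otherwise S has k-i parts among 1,…,k-1,
-- so it contains some part j ≤ i, and w_j extends a K_{r-2} of H lying in
-- the remaining k-1-i parts of S.
--
-- Since `Achievable` quantifies over graphs with
-- arbitrary (undecidable) adjacency, β_i(k,r) is shown to exist by a finite
-- search: every good graph has a good spanning subgraph with decidable edges
-- (the union of its chosen witness cliques), every such graph is encoded by
-- a finite code (parts and neighbourhoods), goodness of a code is decidable,
-- and the least number principle then yields β_i(k,r) below any achievable
-- number of vertices.

open import Defs
open import Data.Nat using (ℕ; zero; suc; _≤_; _<_; _+_; _∸_; z≤n; s≤s)
open import Data.Nat.Properties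
  using (≤-refl; ≤-trans; ≤-reflexive; <⇒≤; ≮⇒≥; anyUpTo?; ≡-irrelevant;
         +-suc; +-comm; +-monoʳ-≤; +-∸-assoc; m∸n+n≡m; 1+n≰n)
  renaming (_≟_ to _≟ℕ_)
import Data.Nat.Properties as ℕ
open import Data.Nat.Induction using (<-rec)
open import Data.Bool using (true)
open import Data.Fin using (Fin; zero; suc; inject≤; punchIn; splitAt; join; _≟_)
open import Data.Fin.Properties
  using (any?; all?; punchIn-injective; punchInᵢ≢i; suc-injective; splitAt-join)
open import Data.Fin.Subset using (Subset; _∈_; ∣_∣; inside; outside)
open import Data.Fin.Subset.Properties using (anySubset?; _∈?_; ∣p∣≤n)
open import Data.Vec.Base using (Vec; []; _∷_; lookup; tabulate; here; there)
open import Data.Vec.Properties using (lookup∘tabulate; []=⇒lookup; lookup⇒[]=)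
open import Data.Product using (Σ; ∃; _×_; _,_; proj₁; proj₂)
open import Data.Sum using (_⊎_; inj₁; inj₂)
open import Data.Empty using (⊥; ⊥-elim)
open import Function using (_∘_)
open import Relation.Binary.PropositionalEquality
  using (_≡_; _≢_; _≗_; refl; trans; cong; subst; subst₂)
import Relation.Binary.PropositionalEquality as Eq
open import Relation.Nullary using (Dec; yes; no; ¬_; does)
open import Relation.Nullary.Decidable
  using (map′; _×-dec_; _→-dec_; ¬?; decidable-stable)

private
  variable
    A B : Set
    i k r n s : ℕ

Searchable : Set → Set₁
Searchable A = ∀ {P : A → Set} → (∀ x → Dec (P x)) → Dec (∃ P)

searchVec : Searchable A → Searchable (Vec A n)
searchVec {n = zero}  search P? = map′ ([] ,_) (λ { ([] , p) → p }) (P? [])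
searchVec {n = suc n} search P? =
  map′ (λ (x , xs , p) → x ∷ xs , p) (λ { (x ∷ xs , p) → x , xs , p })
       (search λ x → searchVec search λ xs → P? (x ∷ xs))

searchProd : Searchable A → Searchable B → Searchable (A × B)
searchProd searchA searchB P? =
  map′ (λ (a , b , p) → (a , b) , p) (λ ((a , b) , p) → a , b , p)
       (searchA λ a → searchB λ b → P? (a , b))

searchAll : Searchable A → {P : A → Set} → (∀ x → Dec (P x)) → Dec (∀ x → P x)
searchAll search P? with search (¬? ∘ P?)
... | yes (x , ¬px) = no λ all → ¬px (all x)
... | no none       = yes λ x → decidable-stable (P? x) λ ¬px → none (x , ¬px)

-- Functions Fin s → A can be searched through their tables, provided the
-- predicate depends only on the values of the function.
searchFun : Searchable A → {P : (Fin s → A) → Set} →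
  (∀ {f g} → f ≗ g → P f → P g) → (∀ f → Dec (P f)) → Dec (∃ P)
searchFun search resp P? =
  map′ (λ (xs , p) → lookup xs , p)
       (λ (f , p) → tabulate f , resp (Eq.sym ∘ lookup∘tabulate f) p)
       (searchVec search (P? ∘ lookup))

decΣ-irrelevant : {Q : A → Set} → (∀ (a a′ : A) → a ≡ a′) →
  Dec A → (∀ a → Dec (Q a)) → Dec (Σ A Q)
decΣ-irrelevant {Q = Q} unique (yes a) Q? =
  map′ (a ,_) (λ (a′ , q) → subst Q (unique a′ a) q) (Q? a)
decΣ-irrelevant unique (no ¬a) Q? = no (¬a ∘ proj₁)

Least : (ℕ → Set) → ℕ → Set
Least P N = Σ ℕ λ b → b ≤ N × P b × (∀ n → n < b → ¬ P n)

least : {P : ℕ → Set} → (∀ n → Dec (P n)) → ∀ N → P N → Least P N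
least {P} P? = <-rec (λ N → P N → Least P N) step
  where
  step : ∀ N → (∀ {n} → n < N → P n → Least P n) → P N → Least P N
  step N below pN with anyUpTo? P? N
  ... | yes (n , n<N , pn) =
    let (b , b≤n , pb , minimal) = below n<N pn
    in  b , ≤-trans b≤n (<⇒≤ n<N) , pb , minimal
  ... | no none = N , ≤-refl , pN , λ n n<N pn → none (n , n<N , pn)

DecAdj : PartiteGraph k n → Set
DecAdj G = ∀ u v → Dec (Adj G u v)

isClique-resp : (G : PartiteGraph k n) {f g : Fin s → Fin n} →
  f ≗ g → IsClique G f → IsClique G g
isClique-resp G f≗g clique a b a≢b = subst₂ (Adj G) (f≗g a) (f≗g b) (clique a b a≢b)

InParts : (G : PartiteGraph k n) → Subset k → (Fin s → Fin n) → Set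
InParts G S f = ∀ a → part G (f a) ∈ S

cliqueIn-resp : (G : PartiteGraph k n) (S : Subset k) {f g : Fin s → Fin n} →
  f ≗ g → IsClique G f × InParts G S f → IsClique G g × InParts G S g
cliqueIn-resp G S f≗g (clique , inS) =
  isClique-resp G f≗g clique , λ a → subst (λ u → part G u ∈ S) (f≗g a) (inS a)

module _ (G : PartiteGraph k n) (adj? : DecAdj G) where

  isClique? : (f : Fin s → Fin n) → Dec (IsClique G f)
  isClique? f = all? λ a → all? λ b → ¬? (a ≟ b) →-dec adj? (f a) (f b)

  hasClique? : ∀ s → Dec (HasClique G s)
  hasClique? s = searchFun any? (isClique-resp G) isClique?

  hasCliqueIn? : ∀ S s → Dec (HasCliqueIn G S s)
  hasCliqueIn? S s = searchFun any? (cliqueIn-resp G S)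
    λ f → isClique? f ×-dec all? λ a → part G (f a) ∈? S

  good? : ∀ i r → Dec (Good i k r n G)
  good? i r = ¬? (hasClique? r) ×-dec searchAll anySubset?
    λ S → (∣ S ∣ ≟ℕ k ∸ i) →-dec hasCliqueIn? S (r ∸ 1)

cliqueFree-sub : (G G′ : PartiteGraph k n) → (∀ {u v} → Adj G′ u v → Adj G u v) →
  ¬ HasClique G s → ¬ HasClique G′ s
cliqueFree-sub G G′ sub free (f , clique) = free (f , λ a b a≢b → sub (clique a b a≢b))

cliqueIn-super : (G G′ : PartiteGraph k n) → (∀ u → part G u ≡ part G′ u) →
  (∀ {u v} → Adj G u v → Adj G′ u v) → ∀ S → HasCliqueIn G S s → HasCliqueIn G′ S s
cliqueIn-super G G′ same sup S (f , clique , inS) =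
  f , (λ a b a≢b → sup (clique a b a≢b)) , λ a → subst (_∈ S) (same (f a)) (inS a)

good-equiv : (G G′ : PartiteGraph k n) → (∀ u → part G u ≡ part G′ u) →
  (∀ {u v} → Adj G u v → Adj G′ u v) → (∀ {u v} → Adj G′ u v → Adj G u v) →
  Good i k r n G → Good i k r n G′
good-equiv G G′ same to from (free , witnesses) =
  cliqueFree-sub G G′ from free ,
  λ S size → cliqueIn-super G G′ same to S (witnesses S size)

-- A code lists the part and the neighbourhood of every vertex.
Code : ℕ → ℕ → Set
Code k n = Vec (Fin k) n × Vec (Subset n) n

searchCode : Searchable (Code k n)
searchCode = searchProd (searchVec any?) (searchVec anySubset?)

-- Symmetrising and demanding distinct
-- parts makes every code describe a valid k-partite graph.
graphOf : Code k n → PartiteGraph k n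
graphOf (parts , nbhd) = record
  { part   = lookup parts
  ; Adj    = λ u v → v ∈ lookup nbhd u × u ∈ lookup nbhd v × lookup parts u ≢ lookup parts v
  ; sym    = λ (v∈ , u∈ , parts≢) → u∈ , v∈ , parts≢ ∘ Eq.sym
  ; irrefl = λ (_ , _ , parts≢) → parts≢ refl
  ; cross  = λ (_ , _ , parts≢) → parts≢
  }

graphOf-decAdj : (c : Code k n) → DecAdj (graphOf c)
graphOf-decAdj (parts , nbhd) u v =
  (v ∈? lookup nbhd u) ×-dec (u ∈? lookup nbhd v) ×-dec ¬? (lookup parts u ≟ lookup parts v)

select : {P : Fin n → Set} → (∀ v → Dec (P v)) → Subset n
select P? = tabulate (does ∘ P?)

select-sound : {P : Fin n → Set} (P? : ∀ v → Dec (P v)) {v : Fin n} → v ∈ select P? → P v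
select-sound P? {v} v∈ = holds (P? v) (trans (Eq.sym (lookup∘tabulate (does ∘ P?) v)) ([]=⇒lookup v∈))
  where
  holds : {Q : Set} (Q? : Dec Q) → does Q? ≡ true → Q
  holds (yes q) _ = q

select-complete : {P : Fin n → Set} (P? : ∀ v → Dec (P v)) {v : Fin n} → P v → v ∈ select P?
select-complete P? {v} pv with P? v in eq
... | yes _ = lookup⇒[]= v (select P?) (trans (lookup∘tabulate (does ∘ P?) v) (cong does eq))
... | no ¬pv = ⊥-elim (¬pv pv)

encode : (G : PartiteGraph k n) → DecAdj G → Code k n
encode G adj? = tabulate (part G) , tabulate λ u → select (adj? u)

encode-good : ∀ {i r} (G : PartiteGraph k n) (adj? : DecAdj G) →
  Good i k r n G → Good i k r n (graphOf (encode G adj?))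
encode-good {i = i} {r = r} G adj? =
  good-equiv {i = i} {r = r} G (graphOf (encode G adj?)) sameParts to from
  where
  sameParts : ∀ u → part G u ≡ lookup (tabulate (part G)) u
  sameParts u = Eq.sym (lookup∘tabulate (part G) u)
  nbhd≡ : ∀ u → lookup (tabulate λ w → select (adj? w)) u ≡ select (adj? u)
  nbhd≡ = lookup∘tabulate (λ w → select (adj? w))
  to : ∀ {u v} → Adj G u v → Adj (graphOf (encode G adj?)) u v
  to {u} {v} uv =
    subst (v ∈_) (Eq.sym (nbhd≡ u)) (select-complete (adj? u) uv) ,
    subst (u ∈_) (Eq.sym (nbhd≡ v)) (select-complete (adj? v) (sym G uv)) ,
    λ parts≡ → cross G uv (trans (sameParts u) (trans parts≡ (Eq.sym (sameParts v))))
  from : ∀ {u v} → Adj (graphOf (encode G adj?)) u v → Adj G u v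
  from {u} {v} (v∈ , _) = select-sound (adj? u) (subst (v ∈_) (nbhd≡ u) v∈)

-- The witness subgraph: the union of the cliques chosen by a proof of
-- goodness is a good spanning subgraph with decidable adjacency.
module WitnessSubgraph {i k r n : ℕ} (G : PartiteGraph k n) (good : Good i k r n G) where

  witness : (S : Subset k) → ∣ S ∣ ≡ k ∸ i → Fin (r ∸ 1) → Fin n
  witness S size = proj₁ (proj₂ good S size)

  WitnessEdge : Fin n → Fin n → Set
  WitnessEdge u v = Σ (Subset k) λ S → Σ (∣ S ∣ ≡ k ∸ i) λ size →
    Σ (Fin (r ∸ 1)) λ a → Σ (Fin (r ∸ 1)) λ b →
    a ≢ b × witness S size a ≡ u × witness S size b ≡ v

  witnessEdge⇒adj : ∀ {u v} → WitnessEdge u v → Adj G u v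
  witnessEdge⇒adj (S , size , a , b , a≢b , refl , refl) =
    proj₁ (proj₂ (proj₂ good S size)) a b a≢b

  witnessEdge? : ∀ u v → Dec (WitnessEdge u v)
  witnessEdge? u v = anySubset? λ S → decΣ-irrelevant ≡-irrelevant (∣ S ∣ ≟ℕ k ∸ i)
    λ size → any? λ a → any? λ b →
      ¬? (a ≟ b) ×-dec (witness S size a ≟ u) ×-dec (witness S size b ≟ v)

  W : PartiteGraph k n
  W = record
    { part   = part G
    ; Adj    = WitnessEdge
    ; sym    = λ (S , size , a , b , a≢b , u≡ , v≡) → S , size , b , a , a≢b ∘ Eq.sym , v≡ , u≡
    ; irrefl = irrefl G ∘ witnessEdge⇒adj
    ; cross  = cross G ∘ witnessEdge⇒adj
    }

  W-good : Good i k r n W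
  W-good = cliqueFree-sub G W witnessEdge⇒adj (proj₁ good) ,
    λ S size → witness S size ,
               (λ a b a≢b → S , size , a , b , a≢b , refl , refl) ,
               proj₂ (proj₂ (proj₂ good S size))

Realisable : (i k r n : ℕ) → Set
Realisable i k r n = Σ (Code k n) λ c → Good i k r n (graphOf c)

realisable? : ∀ i k r n → Dec (Realisable i k r n)
realisable? i k r n = searchCode λ c → good? (graphOf c) (graphOf-decAdj c) i r

realisable⇒achievable : Realisable i k r n → Achievable i k r n
realisable⇒achievable (c , good) = graphOf c , good

achievable⇒realisable : Achievable i k r n → Realisable i k r n
achievable⇒realisable {i = i} {r = r} (G , good) =
  encode W witnessEdge? , encode-good {i = i} {r = r} W witnessEdge? W-good
  where open WitnessSubgraph {i = i} {r = r} G good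

beta-below : ∀ N → Achievable i k r N → Σ ℕ λ b → IsBeta i k r b × b ≤ N
beta-below {i} {k} {r} N achievable
  with least (realisable? i k r) N (achievable⇒realisable {i = i} {r = r} achievable)
... | b , b≤N , realisable , minimal =
  b , (realisable⇒achievable {i = i} {r = r} realisable ,
       λ n achievableₙ → ≮⇒≥ λ n<b →
         minimal n n<b (achievable⇒realisable {i = i} {r = r} achievableₙ)) ,
  b≤N

meetsFirst : (T : Subset n) (i≤n : i ≤ n) → ∣ T ∣ ≡ suc (n ∸ i) →
  Σ (Fin i) λ j → inject≤ j i≤n ∈ T × Σ (Subset n) λ T′ →
    ∣ T′ ∣ ≡ n ∸ i × (∀ q → q ∈ T′ → q ∈ T × q ≢ inject≤ j i≤n)
meetsFirst {n} {zero} T i≤n size =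
  ⊥-elim (1+n≰n (subst (_≤ n) size (∣p∣≤n T)))
meetsFirst {suc n} {suc i} (inside ∷ T) (s≤s i≤n) size =
  zero , here , (outside ∷ T) , ℕ.suc-injective size ,
  λ { (suc q) (there q∈) → there q∈ , λ () }
meetsFirst {suc n} {suc i} (outside ∷ T) (s≤s i≤n) size
  with meetsFirst T i≤n size
... | j , j∈ , T′ , size′ , T′⊆ =
  suc j , there j∈ , (outside ∷ T′) , size′ ,
  λ { (suc q) (there q∈) → there (proj₁ (T′⊆ q q∈)) , proj₂ (T′⊆ q q∈) ∘ suc-injective }

module Extension {k m i : ℕ} (i≤k : i ≤ k) (H : PartiteGraph k m) where

  Vertex : Set
  Vertex = Fin m ⊎ Fin (suc i)

  partOf : Vertex → Fin (suc k)
  partOf (inj₁ x) = suc (part H x)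
  partOf (inj₂ j) = inject≤ j (s≤s i≤k)

  Edge : Vertex → Vertex → Set
  Edge (inj₁ x) (inj₁ y) = Adj H x y
  Edge (inj₁ x) (inj₂ j) = partOf (inj₁ x) ≢ partOf (inj₂ j)
  Edge (inj₂ j) (inj₁ x) = partOf (inj₂ j) ≢ partOf (inj₁ x)
  Edge (inj₂ _) (inj₂ _) = ⊥

  Edge-sym : ∀ w w′ → Edge w w′ → Edge w′ w
  Edge-sym (inj₁ x) (inj₁ y) xy = sym H xy
  Edge-sym (inj₁ x) (inj₂ j) parts≢ = parts≢ ∘ Eq.sym
  Edge-sym (inj₂ j) (inj₁ x) parts≢ = parts≢ ∘ Eq.sym

  Edge-irrefl : ∀ w → ¬ Edge w w
  Edge-irrefl (inj₁ x) = irrefl H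

  Edge-cross : ∀ w w′ → Edge w w′ → partOf w ≢ partOf w′
  Edge-cross (inj₁ x) (inj₁ y) xy = cross H xy ∘ suc-injective
  Edge-cross (inj₁ x) (inj₂ j) parts≢ = parts≢
  Edge-cross (inj₂ j) (inj₁ x) parts≢ = parts≢

  G : PartiteGraph (suc k) (m + suc i)
  G = record
    { part   = partOf ∘ splitAt m
    ; Adj    = λ u v → Edge (splitAt m u) (splitAt m v)
    ; sym    = λ {u} {v} → Edge-sym (splitAt m u) (splitAt m v)
    ; irrefl = λ {u} → Edge-irrefl (splitAt m u)
    ; cross  = λ {u} {v} → Edge-cross (splitAt m u) (splitAt m v)
    }

  EdgeClique : (Fin s → Vertex) → Set
  EdgeClique {s} g = ∀ (a b : Fin s) → a ≢ b → Edge (g a) (g b)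

  IsOld : Vertex → Set
  IsOld w = Σ (Fin m) λ x → w ≡ inj₁ x

  IsNew : Vertex → Set
  IsNew w = Σ (Fin (suc i)) λ j → w ≡ inj₂ j

  isNew? : ∀ w → Dec (IsNew w)
  isNew? (inj₁ x) = no λ { (_ , ()) }
  isNew? (inj₂ j) = yes (j , refl)

  notNew⇒old : ∀ w → ¬ IsNew w → IsOld w
  notNew⇒old (inj₁ x) _      = x , refl
  notNew⇒old (inj₂ j) notNew = ⊥-elim (notNew (j , refl))

  newNeighbour⇒old : ∀ j w → Edge (inj₂ j) w → IsOld w
  newNeighbour⇒old j (inj₁ x) _ = x , refl

  oneNew : (g : Fin (suc s) → Vertex) → EdgeClique g →
    Σ (Fin (suc s)) λ e → ∀ b → b ≢ e → IsOld (g b)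
  oneNew g clique with any? {P = IsNew ∘ g} (isNew? ∘ g)
  ... | yes (e , j , ge≡) = e , λ b b≢e →
    newNeighbour⇒old j (g b) (subst (λ w → Edge w (g b)) ge≡ (clique e b (b≢e ∘ Eq.sym)))
  ... | no noneNew = zero , λ b _ → notNew⇒old (g b) λ gb-new → noneNew (b , gb-new)

  dropNew : ∀ t (g : Fin (suc t) → Vertex) → EdgeClique g → HasClique H t
  dropNew t g clique = h , λ c c′ c≢c′ →
    subst₂ Edge (remaining c) (remaining c′) (clique _ _ (c≢c′ ∘ punchIn-injective e c c′))
    where
    e = proj₁ (oneNew g clique)
    old : ∀ c → IsOld (g (punchIn e c))
    old c = proj₂ (oneNew g clique) (punchIn e c) (punchInᵢ≢i e c)
    h : Fin t → Fin m
    h = proj₁ ∘ old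
    remaining : ∀ c → g (punchIn e c) ≡ inj₁ (h c)
    remaining = proj₂ ∘ old

  G-cliqueFree : ¬ HasClique H (suc s) → ¬ HasClique G (suc (suc s))
  G-cliqueFree {s} free (f , clique) = free (dropNew (suc s) (splitAt m ∘ f) clique)

  cone : (S : Subset (suc k)) (j : Fin (suc i)) (f : Fin s → Fin m) → IsClique H f →
    (∀ c → partOf (inj₁ (f c)) ≢ partOf (inj₂ j)) →
    partOf (inj₂ j) ∈ S → (∀ c → partOf (inj₁ (f c)) ∈ S) → HasCliqueIn G S (suc s)
  cone S j f clique joined j∈S f∈S = join m (suc i) ∘ g , gClique , gInS
    where
    g : Fin (suc _) → Vertex
    g zero    = inj₂ j
    g (suc c) = inj₁ (f c)
    edges : EdgeClique g
    edges zero    zero     a≢b   = ⊥-elim (a≢b refl)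
    edges zero    (suc c)  _     = joined c ∘ Eq.sym
    edges (suc c) zero     _     = joined c
    edges (suc c) (suc c′) c≢c′ = clique c c′ (c≢c′ ∘ cong suc)
    g∈S : ∀ a → partOf (g a) ∈ S
    g∈S zero    = j∈S
    g∈S (suc c) = f∈S c
    splitAt∘join : ∀ a → g a ≡ splitAt m (join m (suc i) (g a))
    splitAt∘join a = Eq.sym (splitAt-join m (suc i) (g a))
    gClique : IsClique G (join m (suc i) ∘ g)
    gClique a b a≢b = subst₂ Edge (splitAt∘join a) (splitAt∘join b) (edges a b a≢b)
    gInS : ∀ a → partOf (splitAt m (join m (suc i) (g a))) ∈ S
    gInS a = subst (λ w → partOf w ∈ S) (splitAt∘join a) (g∈S a)

  shift : suc k ∸ i ≡ suc (k ∸ i)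
  shift = +-∸-assoc 1 i≤k

  -- Every set S of k + 1 - i parts of G carries a clique of size s + 1:
  -- through w_0 if part 0 ∈ S, and otherwise through w_j for a part j ∈ S
  -- among 1,…,i.
  G-witnesses : (∀ T → ∣ T ∣ ≡ k ∸ i → HasCliqueIn H T s) →
    ∀ S → ∣ S ∣ ≡ suc k ∸ i → HasCliqueIn G S (suc s)
  G-witnesses witnesses (inside ∷ T) size
    with witnesses T (ℕ.suc-injective (trans size shift))
  ... | f , clique , f∈T = cone (inside ∷ T) zero f clique (λ c ()) here (there ∘ f∈T)
  G-witnesses witnesses (outside ∷ T) size
    with meetsFirst T i≤k (trans size shift)
  ... | j , j∈T , T′ , size′ , T′⊆T with witnesses T′ size′
  ...   | f , clique , f∈T′ =
    cone (outside ∷ T) (suc j) f clique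
      (λ c → proj₂ (T′⊆T _ (f∈T′ c)) ∘ suc-injective)
      (there j∈T) (λ c → there (proj₁ (T′⊆T _ (f∈T′ c))))

  extension-good : Good i k (suc s) m H → Good i (suc k) (suc (suc s)) (m + suc i) G
  extension-good (free , witnesses) = G-cliqueFree free , G-witnesses witnesses

∸+1≤ : ∀ {n k} → 1 ≤ n → n ≤ k → k ∸ n + 1 ≤ k
∸+1≤ {n} {k} 1≤n n≤k = ≤-trans (+-monoʳ-≤ (k ∸ n) 1≤n) (≤-reflexive (m∸n+n≡m n≤k))

lemma3p3 : (k r i : ℕ) → 3 ≤ r → r ≤ k → 1 ≤ i → i ≤ k ∸ r + 1 →
    (m : ℕ) → IsBeta i (k ∸ 1) (r ∸ 1) m →
    Σ ℕ λ b → IsBeta i k r b × b ≤ m + i + 1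
lemma3p3 (suc k) (suc (suc (suc r))) i (s≤s (s≤s (s≤s _))) (s≤s r+2≤k) _ i≤k∸[r+2]+1 m
         ((H , H-good) , _) =
  let b , isBeta , b≤ = beta-below {i = i} (m + suc i)
                          (Extension.G i≤k H , Extension.extension-good i≤k H H-good)
  in  b , isBeta , ≤-trans b≤ (≤-reflexive m+[i+1]≡m+i+1)
  where
  i≤k : i ≤ k
  i≤k = ≤-trans i≤k∸[r+2]+1 (∸+1≤ (s≤s z≤n) r+2≤k)
  m+[i+1]≡m+i+1 : m + suc i ≡ m + i + 1
  m+[i+1]≡m+i+1 = trans (+-suc m i) (+-comm 1 (m + i))
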